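{- Let $n>0$ with $n\equiv3\pmod 4$. Then $\varphi(t^{4n-5})=w^{10n-9}$, $\varphi(t^{4n-1})=w^{10n-3}$, $\varphi(t^{4n+1})=w^{10n-7}$, and $\varphi(t^{4n+3})=w^{10n-1}$.
   Context: Let $V=t\,\mathbb{Z}/2[t^2]$ and let $V'\subset\mathbb{Z}/2[w]$ be spanned by the $w^k$ with $k\equiv1,3,7,9\pmod{20}$. $\varphi:V\to V'$ is the $\mathbb{Z}/2$-linear map with $\varphi(t),\varphi(t^3),\varphi(t^5),\varphi(t^9)=w,w^3,w^7,w^9$; $\varphi(t^7),\varphi(t^{11}),\varphi(t^{13}),\varphi(t^{15})=w^{21},w^{27},w^{23},w^{29}$; and $\varphi(t^{16}f)=w^{40}\varphi(f)$ for $f\in V$. -}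

module Defs where

open import Data.Nat using (ℕ; zero; suc; _+_; _*_; _/_; _%_)
open import Data.Bool using (Bool; true; false; not)
open import Data.List using (List; []; _∷_; map)
open import Relation.Binary.PropositionalEquality using (_≡_)

-- Polynomials over ℤ/2 in one variable, represented as formal sums of
-- monomials: a list of exponents [k₁,…,kᵣ] stands for x^k₁ + … + x^kᵣ.
-- Two formal sums are equal as polynomials iff all coefficients (parity of
-- the number of occurrences of each exponent) agree.
Poly₂ : Set
Poly₂ = List ℕ

eqℕ : ℕ → ℕ → Bool
eqℕ zero zero = true
eqℕ zero (suc _) = false
eqℕ (suc _) zero = false
eqℕ (suc m) (suc n) = eqℕ m n

coeff : Poly₂ → ℕ → Bool
coeff [] j = false
coeff (k ∷ p) j with eqℕ k j
... | true  = not (coeff p j)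
... | false = coeff p j

_≈₂_ : Poly₂ → Poly₂ → Set
p ≈₂ q = ∀ j → coeff p j ≡ coeff q j

mono : ℕ → Poly₂
mono k = k ∷ []

-- Exponent of φ(t^k) for odd k:  write k = 16q + r with r odd, r < 16;
-- φ(t^r) = w^{e(r)} with the table from the paper, and φ(t^{16}f) = w^{40}φ(f).
eTable : ℕ → ℕ
eTable 1  = 1
eTable 3  = 3
eTable 5  = 7
eTable 9  = 9
eTable 7  = 21
eTable 11 = 27
eTable 13 = 23
eTable 15 = 29
eTable _  = 0   -- never used: r is always odd

φexp : ℕ → ℕ
φexp k = 40 * (k / 16) + eTable (k % 16)

-- V = t·ℤ/2[t²]: formal sums of odd-exponent monomials in t.
-- φ : V → V' is the ℤ/2-linear map sending t^k to w^{φexp k}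
-- (linear extension to formal sums).
φ : Poly₂ → Poly₂
φ = map φexp

module Submission where

-- Write n = 3 + 4q (possible since n ≡ 3 mod 4).  Then
--   4n - 5 = 7 + 16q,  4n - 1 = 11 + 16q,  4n + 1 = 13 + 16q,  4n + 3 = 15 + 16q,
-- and φ(t^(r + 16q)) = w^(e(r) + 40q) for every residue r < 16, where e is the
-- table of φ on t, t³, …, t¹⁵.  Reading off e(7), e(11), e(13), e(15) = 21, 27,
-- 23, 29 gives exactly the exponents 10n - 9, 10n - 3, 10n - 7, 10n - 1, since
-- 10n = 30 + 40q.

open import Defs
open import Data.Nat using (ℕ; _+_; _*_; _∸_; _%_; _/_; _<_; _<ᵇ_)
open import Data.Bool using (T)
open import Data.Nat.Properties using (+-comm; *-comm; <ᵇ⇒<)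
open import Data.Nat.DivMod
  using (+-distrib-/-∣ʳ; m*n/n≡m; [m+kn]%n≡m%n; m<n⇒m%n≡m; m<n⇒m/n≡0; m≡m%n+[m/n]*n)
open import Data.Nat.Divisibility using (divides-refl)
open import Data.Nat.Tactic.RingSolver using (solve-∀)
open import Data.Product using (_×_; _,_)
open import Relation.Binary.PropositionalEquality using (_≡_; refl; cong; cong₂; trans; sym)
open Relation.Binary.PropositionalEquality.≡-Reasoning

-- φ sends the monomial t^a to the monomial w^(φexp a); stated up to an
-- equality of exponents so that it applies to exponents written differently.
φ-mono : ∀ a {b} → φexp a ≡ b → φ (mono a) ≈₂ mono b
φ-mono a refl j = refl

φexp-periodic : ∀ r q → r < 16 → φexp (r + q * 16) ≡ eTable r + q * 40
φexp-periodic r q r<16 = begin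
  40 * ((r + q * 16) / 16) + eTable ((r + q * 16) % 16) ≡⟨ cong₂ (λ a b → 40 * a + eTable b) quotient remainder ⟩
  40 * q + eTable r                                     ≡⟨ +-comm (40 * q) (eTable r) ⟩
  eTable r + 40 * q                                     ≡⟨ cong (eTable r +_) (*-comm 40 q) ⟩
  eTable r + q * 40                                     ∎
  where
  quotient : (r + q * 16) / 16 ≡ q
  quotient = begin
    (r + q * 16) / 16       ≡⟨ +-distrib-/-∣ʳ r (divides-refl q) ⟩
    r / 16 + q * 16 / 16    ≡⟨ cong₂ _+_ (m<n⇒m/n≡0 r<16) (m*n/n≡m q 16) ⟩
    q                       ∎

  remainder : (r + q * 16) % 16 ≡ r
  remainder = trans ([m+kn]%n≡m%n r q 16) (m<n⇒m%n≡m r<16)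

φ-block : ∀ r q {a b} → r < 16 → a ≡ r + q * 16 → eTable r + q * 40 ≡ b →
          φ (mono a) ≈₂ mono b
φ-block r q r<16 refl refl = φ-mono (r + q * 16) (φexp-periodic r q r<16)

residue-3-mod-4 : ∀ n → n % 4 ≡ 3 → n ≡ 3 + n / 4 * 4
residue-3-mod-4 n n%4≡3 = trans (m≡m%n+[m/n]*n n 4) (cong (_+ n / 4 * 4) n%4≡3)

-- With n = 3 + 4q, the multiples 4n and 10n in the statement become
-- 12 + 16q and 30 + 40q; in this form 4n ∸ 5 reduces definitionally to
-- 7 + 16q, 10n ∸ 9 to 21 + 40q = e(7) + 40q, and so on.
scale-4 : ∀ q → 4 * (3 + q * 4) ≡ 12 + q * 16
scale-4 = solve-∀

scale-10 : ∀ q → 10 * (3 + q * 4) ≡ 30 + q * 40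
scale-10 = solve-∀

lemma6p2 : (n : ℕ) → 0 < n → n % 4 ≡ 3 →
    (φ (mono (4 * n ∸ 5)) ≈₂ mono (10 * n ∸ 9))
    × (φ (mono (4 * n ∸ 1)) ≈₂ mono (10 * n ∸ 3))
    × (φ (mono (4 * n + 1)) ≈₂ mono (10 * n ∸ 7))
    × (φ (mono (4 * n + 3)) ≈₂ mono (10 * n ∸ 1))
lemma6p2 n _ n%4≡3 with n / 4 | residue-3-mod-4 n n%4≡3
... | q | refl =
    φ-block 7  q r<16 (cong (_∸ 5) (scale-4 q)) (sym (cong (_∸ 9) (scale-10 q)))
  , φ-block 11 q r<16 (cong (_∸ 1) (scale-4 q)) (sym (cong (_∸ 3) (scale-10 q)))
  , φ-block 13 q r<16 (trans (cong (_+ 1) (scale-4 q)) (+-comm (12 + q * 16) 1)) (sym (cong (_∸ 7) (scale-10 q)))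
  , φ-block 15 q r<16 (trans (cong (_+ 3) (scale-4 q)) (+-comm (12 + q * 16) 3)) (sym (cong (_∸ 1) (scale-10 q)))
  where
  r<16 : ∀ {r} → {T (r <ᵇ 16)} → r < 16
  r<16 {r} {r<ᵇ16} = <ᵇ⇒< r 16 r<ᵇ16
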